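{- Let $A,B\in\mathbb Z^{d\times d}$ be nonsingular and let $\sigma_1,\sigma_2\in\mathfrak S_d$ be such that $\hat\phi(A\cdot\sigma_1)=\hat\phi(B\cdot\sigma_2)=(M_1,\dots,M_d)$ with $$M_1=\cdots=M_{m_1}<_{\mathrm{rlex}}M_{m_1+1}=\cdots=M_{m_1+m_2}<_{\mathrm{rlex}}\cdots<_{\mathrm{rlex}}M_{m_1+\cdots+m_{s-1}+1}=\cdots=M_{m_1+\cdots+m_s}=M_d.$$ Let $\mathcal S_{\mathrm{SNF}}=\sigma_2\,\mathfrak S_{(m_1,\dots,m_s)}\,\sigma_1^{ -1}$. Then $A\simeq_{\mathrm{UP}}B$ if and only if $A\simeq_{\mathcal S_{\mathrm{SNF}}}B$.
   Context: For $\sigma\in\mathfrak S_d$, $M\cdot\sigma=M(\mathbf e_{\sigma(1)}|\cdots|\mathbf e_{\sigma(d)})$. For $\mathcal I\subseteq\mathfrak S_d$, $A\simeq_{\mathcal I}B$ means $UA=B\cdot g$ for some $U\in\mathrm{GL}_d(\mathbb Z)$, $g\in\mathcal I$; $\simeq_{\mathrm{UP}}$ is $\simeq_{\mathfrak S_d}$. $\mathrm{SNF}(X)$ is the Smith normal form of an integer matrix $X$; $A\langle\hat i\rangle$ is $A$ with column $i$ deleted, and $\hat\phi(A)=(\mathrm{SNF}(A\langle\hat1\rangle),\dots,\mathrm{SNF}(A\langle\hat d\rangle))$. $X<_{\mathrm{rlex}}Y$ if at the first differing entry (rows top to bottom, each row right to left) $X$'s entry is smaller. $\mathfrak S_{(m_1,\dots,m_s)}=\mathfrak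 S_{w_1}\times\cdots\times\mathfrak S_{w_s}$ with $w_i=\{m_1+\dots+m_{i-1}+1,\dots,m_1+\dots+m_i\}$. -}

module Defs where

open import Data.Nat using (ℕ; zero; suc; _≤_; _<_; _≟_)
open import Data.Fin using (Fin; zero; suc; toℕ; punchIn)
open import Data.Fin.Permutation using (Permutation′; _⟨$⟩ʳ_; _⟨$⟩ˡ_)
open import Data.Integer using (ℤ; 0ℤ; 1ℤ; -_) renaming (_+_ to _+ℤ_; _*_ to _*ℤ_; _≤_ to _≤ℤ_; _<_ to _<ℤ_)
open import Data.Integer.Divisibility using () renaming (_∣_ to _∣ℤ_)
open import Data.List using (List; []; _∷_; take; length)
open import Data.Nat.ListAction using (sum)
open import Data.Product using (Σ; ∃; _×_; _,_)
open import Relation.Binary.PropositionalEquality using (_≡_; _≢_)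
open import Relation.Nullary using (Dec; yes; no)

Mat : ℕ → ℕ → Set
Mat r c = Fin r → Fin c → ℤ

_≐_ : ∀ {r c} → Mat r c → Mat r c → Set
X ≐ Y = ∀ i j → X i j ≡ Y i j

Σᶠ : ∀ {n} → (Fin n → ℤ) → ℤ
Σᶠ {zero} f = 0ℤ
Σᶠ {suc n} f = f zero +ℤ Σᶠ (λ i → f (suc i))

_⊗_ : ∀ {r k c} → Mat r k → Mat k c → Mat r c
(X ⊗ Y) i j = Σᶠ (λ l → X i l *ℤ Y l j)

idM : ∀ {n} → Mat n n
idM i j with toℕ i ≟ toℕ j
... | yes _ = 1ℤ
... | no _ = 0ℤ

GL : ∀ n → Mat n n → Set
GL n U = Σ (Mat n n) λ W → ((U ⊗ W) ≐ idM) × ((W ⊗ U) ≐ idM)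

sgn : ℕ → ℤ
sgn zero = 1ℤ
sgn (suc k) = - sgn k

det : ∀ {n} → Mat n n → ℤ
det {zero} M = 1ℤ
det {suc n} M = Σᶠ (λ j → sgn (toℕ j) *ℤ (M zero j *ℤ det (λ a b → M (suc a) (punchIn j b))))

Nonsingular : ∀ {n} → Mat n n → Set
Nonsingular M = det M ≢ 0ℤ

-- M · σ = M (e_{σ(1)} | ... | e_{σ(d)}), i.e. (M·σ)_{ij} = M_{i,σ(j)}
_·_ : ∀ {r d} → Mat r d → Permutation′ d → Mat r d
(M · σ) i j = M i (σ ⟨$⟩ʳ j)

delCol : ∀ {r n} → Mat r (suc n) → Fin (suc n) → Mat r n
delCol A i a b = A a (punchIn i b)

IsSNF : ∀ {r c} → Mat r c → Set
IsSNF {r} {c} S =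
  (∀ i j → toℕ i ≢ toℕ j → S i j ≡ 0ℤ)
  × (∀ i j → toℕ i ≡ toℕ j → 0ℤ ≤ℤ S i j)
  × (∀ i j i′ j′ → toℕ i ≡ toℕ j → toℕ i′ ≡ toℕ j′ → suc (toℕ i) ≡ toℕ i′ → S i j ∣ℤ S i′ j′)

IsSNFOf : ∀ {r c} → Mat r c → Mat r c → Set
IsSNFOf {r} {c} X S =
  IsSNF S × Σ (Mat r r) λ U → Σ (Mat c c) λ V → GL r U × GL c V × (((U ⊗ X) ⊗ V) ≐ S)

-- reverse-lex order: rows top to bottom, each row right to left
Before : ∀ {r c} → (Fin r × Fin c) → (Fin r × Fin c) → Set
Before (i , j) (i′ , j′) = (toℕ i < toℕ i′) ⊎′ ((toℕ i ≡ toℕ i′) × (toℕ j′ < toℕ j))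
  where open import Data.Sum using () renaming (_⊎_ to _⊎′_)

_<rlex_ : ∀ {r c} → Mat r c → Mat r c → Set
X <rlex Y = ∃ λ i → ∃ λ j →
  (∀ i′ j′ → Before (i′ , j′) (i , j) → X i′ j′ ≡ Y i′ j′) × (X i j <ℤ Y i j)

-- block structure of a composition (m₁,…,mₛ): position j (0-based) lies in block k
-- (0-based) iff m₁+…+m_k ≤ j < m₁+…+m_{k+1}
InBlock : ∀ {d} → List ℕ → ℕ → Fin d → Set
InBlock m k j = (sum (take k m) ≤ toℕ j) × (toℕ j < sum (take (suc k) m))

Young : ∀ {d} → List ℕ → Permutation′ d → Set
Young {d} m τ = ∀ (k : ℕ) (j : Fin d) → InBlock m k j → InBlock m k (τ ⟨$⟩ʳ j)

Chain : ∀ {d r c} → List ℕ → (Fin d → Mat r c) → Set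
Chain {d} m M =
  (∀ k (j j′ : Fin d) → k < length m → InBlock m k j → InBlock m k j′ → M j ≐ M j′)
  × (∀ k (j j′ : Fin d) → suc k < length m → InBlock m k j → InBlock m (suc k) j′ → M j <rlex M j′)

Equiv : ∀ {d} → (Permutation′ d → Set) → Mat d d → Mat d d → Set
Equiv {d} I A B = Σ (Mat d d) λ U → Σ (Permutation′ d) λ g → GL d U × I g × ((U ⊗ A) ≐ (B · g))

AllPerms : ∀ {d} → Permutation′ d → Set
AllPerms _ = Data.Unit.⊤
  where import Data.Unit

_≃UP_ : ∀ {d} → Mat d d → Mat d d → Set
A ≃UP B = Equiv AllPerms A B

SSNF : ∀ {d} → List ℕ → Permutation′ d → Permutation′ d → Permutation′ d → Set
SSNF {d} m σ₁ σ₂ g = Σ (Permutation′ d) λ τ → Young m τ × (∀ x → g ⟨$⟩ʳ x ≡ σ₂ ⟨$⟩ʳ (τ ⟨$⟩ʳ (σ₁ ⟨$⟩ˡ x)))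

{-# OPTIONS --safe #-}
module Submission where

-- If U A = B g with U unimodular, then τ = σ₂⁻¹ g σ₁ satisfies U (A σ₁) = (B σ₂) τ. So deleting
-- column j of A σ₁ gives, up to U and a permutation of the columns, B σ₂ with column τ(j) deleted.
-- These two matrices have the same determinantal divisors, which determine the Smith normal form,
-- hence M_j = M_τ(j). As the M_j increase strictly in the reverse-lexicographic order from one
-- block of (m₁,…,mₛ) to the next, τ preserves the blocks, i.e. g ∈ σ₂ 𝔖_(m₁,…,mₛ) σ₁⁻¹.

open import Defs
open import Data.Empty using (⊥-elim)
open import Data.Fin using (Fin; zero; suc; toℕ; punchIn; fromℕ<; inject₁; inject≤)
open import Data.Fin.Permutation
  using (Permutation′; _⟨$⟩ʳ_; _⟨$⟩ˡ_; _∘ₚ_; flip; remove; inverseʳ; punchIn-permute)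
open import Data.Integer
  using (ℤ; 0ℤ; 1ℤ; +0; +[1+_]; -[1+_]; -_; _+_; _*_; +≤+; nonNegative; ≢-nonZero)
  renaming (_≤_ to _≤ℤ_; _<_ to _<ℤ_)
open import Data.Integer.Divisibility.Signed
  using ( _∣_; divides; ∣-refl; ∣-reflexive; ∣-trans; ∣m∣n⇒∣m+n; ∣n⇒∣m*n; *-monoˡ-∣; *-monoʳ-∣
        ; ∣⇒∣ᵤ; ∣ᵤ⇒∣; 0∣⇒≡0)
open import Data.Integer.Tactic.RingSolver using (solve-∀)
open import Data.List using (List; []; _∷_; take; length)
open import Data.List.Relation.Unary.All using (All; _∷_)
open import Data.Nat as ℕ using (ℕ; zero; suc; z≤n; s≤s; _≤_; _<_; _∸_) renaming (_+_ to _+ℕ_)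
open import Data.Nat.ListAction using (sum)
open import Data.Product using (∃; ∃₂; _×_; _,_; proj₁; proj₂)
open import Data.Sum using (_⊎_; inj₁; inj₂)
open import Data.Unit using (tt)
open import Data.Vec.Functional using () renaming ([] to []ᶠ; _∷_ to _∷ᶠ_)
open import Function using (_∘_; _⇔_; mk⇔; Equivalence)
open import Function.Properties.Equivalence using () renaming (sym to ⇔-sym; trans to ⇔-trans)
open import Relation.Binary.Bundles using (Setoid)
open import Relation.Binary.Definitions using (tri<; tri≈; tri>)
open import Relation.Binary.PropositionalEquality
open import Relation.Nullary using (¬_; yes; no; _×-dec_)
import Data.Fin.Properties as Fin
import Data.Integer
import Data.Integer.Properties as ℤ
import Data.List.Properties as List
import Data.Nat.Divisibility as ℕ
import Data.Nat.Properties as ℕ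
import Relation.Binary.Reasoning.Setoid as SetoidReasoning
open import Algebra.Properties.CommutativeMonoid.Sum ℤ.*-1-commutativeMonoid
  using () renaming (sum to ∏ᶠ; sum-cong-≗ to ∏ᶠ-cong; sum-remove to ∏ᶠ-remove; sum-init-last to ∏ᶠ-init-last)

i≡-i⇒i≡0 : ∀ {i} → i ≡ - i → i ≡ 0ℤ
i≡-i⇒i≡0 {+0}       _  = refl
i≡-i⇒i≡0 {+[1+ _ ]} ()
i≡-i⇒i≡0 { -[1+ _ ]} ()

∣0ℤ : ∀ {g} → g ∣ 0ℤ
∣0ℤ = divides 0ℤ refl

∣-* : ∀ {a b c d} → a ∣ b → c ∣ d → a * c ∣ b * d
∣-* {b = b} {c} a∣b c∣d = ∣-trans (*-monoˡ-∣ c a∣b) (*-monoʳ-∣ b c∣d)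

∣-antisym-nonneg : ∀ {a b} → 0ℤ ≤ℤ a → 0ℤ ≤ℤ b → a ∣ b → b ∣ a → a ≡ b
∣-antisym-nonneg 0≤a 0≤b a∣b b∣a =
  trans (sym (ℤ.0≤i⇒+∣i∣≡i 0≤a))
        (trans (cong Data.Integer.+_ (ℕ.∣-antisym (∣⇒∣ᵤ a∣b) (∣⇒∣ᵤ b∣a))) (ℤ.0≤i⇒+∣i∣≡i 0≤b))

-- Finite sums and products

Σᶠ-cong : ∀ {n} {f g : Fin n → ℤ} → (∀ i → f i ≡ g i) → Σᶠ f ≡ Σᶠ g
Σᶠ-cong {zero}  f≗g = refl
Σᶠ-cong {suc n} f≗g = cong₂ _+_ (f≗g zero) (Σᶠ-cong (f≗g ∘ suc))

Σᶠ-zero : ∀ {n} {f : Fin n → ℤ} → (∀ i → f i ≡ 0ℤ) → Σᶠ f ≡ 0ℤ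
Σᶠ-zero {zero}  f≡0 = refl
Σᶠ-zero {suc n} f≡0 = cong₂ _+_ (f≡0 zero) (Σᶠ-zero (f≡0 ∘ suc))

Σᶠ-select : ∀ {n} (f : Fin n → ℤ) i → (∀ l → l ≢ i → f l ≡ 0ℤ) → Σᶠ f ≡ f i
Σᶠ-select f zero f≡0 =
  trans (cong (f zero +_) (Σᶠ-zero (λ l → f≡0 (suc l) λ ()))) (ℤ.+-identityʳ (f zero))
Σᶠ-select f (suc i) f≡0 =
  trans (cong₂ _+_ (f≡0 zero λ ()) (Σᶠ-select (f ∘ suc) i (λ l l≢i → f≡0 (suc l) (l≢i ∘ Fin.suc-injective))))
        (ℤ.+-identityˡ (f (suc i)))

Σᶠ-distrib-+ : ∀ {n} (f g : Fin n → ℤ) → Σᶠ (λ i → f i + g i) ≡ Σᶠ f + Σᶠ g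
Σᶠ-distrib-+ {zero}  f g = refl
Σᶠ-distrib-+ {suc n} f g =
  trans (cong (f zero + g zero +_) (Σᶠ-distrib-+ (f ∘ suc) (g ∘ suc)))
        (interchange (f zero) (g zero) (Σᶠ (f ∘ suc)) (Σᶠ (g ∘ suc)))
  where
  interchange : ∀ a b c d → a + b + (c + d) ≡ a + c + (b + d)
  interchange = solve-∀

Σᶠ-comm : ∀ {m n} (f : Fin m → Fin n → ℤ) → Σᶠ (λ i → Σᶠ (f i)) ≡ Σᶠ (λ j → Σᶠ (λ i → f i j))
Σᶠ-comm {zero}  {n} f = sym (Σᶠ-zero {n} (λ _ → refl))
Σᶠ-comm {suc m}     f =
  trans (cong (Σᶠ (f zero) +_) (Σᶠ-comm (f ∘ suc)))
        (sym (Σᶠ-distrib-+ (f zero) (λ j → Σᶠ (λ i → f (suc i) j))))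

*-distribˡ-Σᶠ : ∀ {n} c (f : Fin n → ℤ) → c * Σᶠ f ≡ Σᶠ (λ i → c * f i)
*-distribˡ-Σᶠ {zero}  c f = ℤ.*-zeroʳ c
*-distribˡ-Σᶠ {suc n} c f =
  trans (ℤ.*-distribˡ-+ c (f zero) (Σᶠ (f ∘ suc)))
        (cong (c * f zero +_) (*-distribˡ-Σᶠ c (f ∘ suc)))

*-distribʳ-Σᶠ : ∀ {n} c (f : Fin n → ℤ) → Σᶠ f * c ≡ Σᶠ (λ i → f i * c)
*-distribʳ-Σᶠ c f =
  trans (ℤ.*-comm (Σᶠ f) c) (trans (*-distribˡ-Σᶠ c f) (Σᶠ-cong (λ i → ℤ.*-comm c (f i))))

scale-Σᶠ : ∀ {n} c (f g : Fin n → ℤ) → (∀ i → c * f i ≡ g i) → c * Σᶠ f ≡ Σᶠ g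
scale-Σᶠ c f g cf≗g = trans (*-distribˡ-Σᶠ c f) (Σᶠ-cong cf≗g)

neg-distrib-Σᶠ : ∀ {n} (f : Fin n → ℤ) → - Σᶠ f ≡ Σᶠ (λ i → - f i)
neg-distrib-Σᶠ {zero}  f = refl
neg-distrib-Σᶠ {suc n} f =
  trans (ℤ.neg-distrib-+ (f zero) (Σᶠ (f ∘ suc))) (cong (- f zero +_) (neg-distrib-Σᶠ (f ∘ suc)))

∣-Σᶠ : ∀ {n g} (f : Fin n → ℤ) → (∀ i → g ∣ f i) → g ∣ Σᶠ f
∣-Σᶠ {zero}  f g∣f = ∣0ℤ
∣-Σᶠ {suc n} f g∣f = ∣m∣n⇒∣m+n (g∣f zero) (∣-Σᶠ (f ∘ suc) (g∣f ∘ suc))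

∏ᶠ-nonneg : ∀ {n} (f : Fin n → ℤ) → (∀ i → 0ℤ ≤ℤ f i) → 0ℤ ≤ℤ ∏ᶠ f
∏ᶠ-nonneg {zero}  f 0≤f = +≤+ z≤n
∏ᶠ-nonneg {suc n} f 0≤f =
  ℤ.*-monoʳ-≤-nonNeg (∏ᶠ (f ∘ suc)) {{nonNegative (∏ᶠ-nonneg (f ∘ suc) (0≤f ∘ suc))}} (0≤f zero)

∏ᶠ≡0⇒factor≡0 : ∀ {n} (f : Fin n → ℤ) → ∏ᶠ f ≡ 0ℤ → ∃ λ i → f i ≡ 0ℤ
∏ᶠ≡0⇒factor≡0 {suc n} f ∏f≡0 with ℤ.i*j≡0⇒i≡0∨j≡0 (f zero) ∏f≡0
... | inj₁ f0≡0 = zero , f0≡0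
... | inj₂ ∏≡0 with ∏ᶠ≡0⇒factor≡0 (f ∘ suc) ∏≡0
...   | i , fi≡0 = suc i , fi≡0

prefixProduct : (ℕ → ℤ) → ℕ → ℤ
prefixProduct f k = ∏ᶠ {k} (f ∘ toℕ)

prefixProduct-suc : ∀ f k → prefixProduct f (suc k) ≡ prefixProduct f k * f k
prefixProduct-suc f k =
  trans (∏ᶠ-init-last {k} (f ∘ toℕ))
        (cong₂ _*_ (∏ᶠ-cong {k} {f ∘ toℕ ∘ inject₁} {f ∘ toℕ} (cong f ∘ Fin.toℕ-inject₁))
                   (cong f (Fin.toℕ-fromℕ k)))

prefixProduct-nonneg : ∀ f → (∀ x → 0ℤ ≤ℤ f x) → ∀ k → 0ℤ ≤ℤ prefixProduct f k
prefixProduct-nonneg f 0≤f k = ∏ᶠ-nonneg {k} (f ∘ toℕ) (0≤f ∘ toℕ)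

-- If κ : Fin (suc k) → Fin n is injective, some κ b is at least k (pigeonhole): peel it off and recurse.
prefixProduct-∣-or-collision : ∀ {n} (f : ℕ → ℤ) → (∀ {x y} → x ≤ y → f x ∣ f y) →
  ∀ k (κ : Fin k → Fin n) → prefixProduct f k ∣ ∏ᶠ (f ∘ toℕ ∘ κ) ⊎ ∃₂ λ b b′ → b ≢ b′ × κ b ≡ κ b′
prefixProduct-∣-or-collision f mono zero    κ = inj₁ ∣-refl
prefixProduct-∣-or-collision f mono (suc k) κ with Fin.any? (λ b → k ℕ.≤? toℕ (κ b))
... | yes (b , k≤κb) with prefixProduct-∣-or-collision f mono k (κ ∘ punchIn b)
...   | inj₁ ∣rest = inj₁ (subst₂ _∣_ (sym (prefixProduct-suc f k)) ∏≡ (∣-* ∣rest (mono k≤κb)))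
  where
  ∏≡ : ∏ᶠ (f ∘ toℕ ∘ κ ∘ punchIn b) * f (toℕ (κ b)) ≡ ∏ᶠ (f ∘ toℕ ∘ κ)
  ∏≡ = trans (ℤ.*-comm _ (f (toℕ (κ b)))) (sym (∏ᶠ-remove {i = b} (f ∘ toℕ ∘ κ)))
...   | inj₂ (b₁ , b₂ , b₁≢b₂ , κb₁≡κb₂) =
  inj₂ (punchIn b b₁ , punchIn b b₂ , b₁≢b₂ ∘ Fin.punchIn-injective b b₁ b₂ , κb₁≡κb₂)
prefixProduct-∣-or-collision f mono (suc k) κ | no ∄b
  with Fin.pigeonhole (ℕ.n<1+n k) (λ b → fromℕ< (ℕ.≰⇒> (λ k≤κb → ∄b (b , k≤κb))))
... | b , b′ , b<b′ , same =
  inj₂ (b , b′ , (λ b≡b′ → ℕ.<-irrefl (cong toℕ b≡b′) b<b′) ,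
        Fin.toℕ-injective (trans (sym (Fin.toℕ-fromℕ< _)) (trans (cong toℕ same) (Fin.toℕ-fromℕ< _))))

Σ→ : ∀ {k r} → ((Fin k → Fin r) → ℤ) → ℤ
Σ→ {zero}  F = F []ᶠ
Σ→ {suc k} F = Σᶠ (λ l → Σ→ (λ h → F (l ∷ᶠ h)))

Σ→-cong : ∀ {k r} {F G : (Fin k → Fin r) → ℤ} → (∀ h → F h ≡ G h) → Σ→ F ≡ Σ→ G
Σ→-cong {zero}  F≗G = F≗G []ᶠ
Σ→-cong {suc k} F≗G = Σᶠ-cong (λ l → Σ→-cong (λ h → F≗G (l ∷ᶠ h)))

*-distribˡ-Σ→ : ∀ {k r} c (F : (Fin k → Fin r) → ℤ) → c * Σ→ F ≡ Σ→ (λ h → c * F h)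
*-distribˡ-Σ→ {zero}  c F = refl
*-distribˡ-Σ→ {suc k} c F =
  trans (*-distribˡ-Σᶠ c (λ l → Σ→ (λ h → F (l ∷ᶠ h))))
        (Σᶠ-cong (λ l → *-distribˡ-Σ→ c (λ h → F (l ∷ᶠ h))))

Σ→-Σᶠ-comm : ∀ {k r n} (F : (Fin k → Fin r) → Fin n → ℤ) →
  Σ→ (λ h → Σᶠ (F h)) ≡ Σᶠ (λ j → Σ→ (λ h → F h j))
Σ→-Σᶠ-comm {zero}  F = refl
Σ→-Σᶠ-comm {suc k} F =
  trans (Σᶠ-cong (λ l → Σ→-Σᶠ-comm (λ h → F (l ∷ᶠ h))))
        (Σᶠ-comm (λ l j → Σ→ (λ h → F (l ∷ᶠ h) j)))

∣-Σ→ : ∀ {k r g} (F : (Fin k → Fin r) → ℤ) → (∀ h → g ∣ F h) → g ∣ Σ→ F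
∣-Σ→ {zero}  F g∣F = g∣F []ᶠ
∣-Σ→ {suc k} F g∣F = ∣-Σᶠ _ (λ l → ∣-Σ→ (λ h → F (l ∷ᶠ h)) (λ h → g∣F (l ∷ᶠ h)))

-- Matrices

≐-refl : ∀ {r c} {X : Mat r c} → X ≐ X
≐-refl i j = refl

≐-sym : ∀ {r c} {X Y : Mat r c} → X ≐ Y → Y ≐ X
≐-sym X≐Y i j = sym (X≐Y i j)

≐-trans : ∀ {r c} {X Y Z : Mat r c} → X ≐ Y → Y ≐ Z → X ≐ Z
≐-trans X≐Y Y≐Z i j = trans (X≐Y i j) (Y≐Z i j)

≐-setoid : ℕ → ℕ → Setoid _ _
≐-setoid r c = record
  { Carrier       = Mat r c
  ; _≈_           = _≐_
  ; isEquivalence = record { refl = ≐-refl ; sym = ≐-sym ; trans = ≐-trans }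
  }

⊗-cong : ∀ {r k c} {X X′ : Mat r k} {Y Y′ : Mat k c} → X ≐ X′ → Y ≐ Y′ → (X ⊗ Y) ≐ (X′ ⊗ Y′)
⊗-cong X≐X′ Y≐Y′ i j = Σᶠ-cong (λ l → cong₂ _*_ (X≐X′ i l) (Y≐Y′ l j))

⊗-assoc : ∀ {r k m c} (X : Mat r k) (Y : Mat k m) (Z : Mat m c) → ((X ⊗ Y) ⊗ Z) ≐ (X ⊗ (Y ⊗ Z))
⊗-assoc X Y Z i j = begin
  Σᶠ (λ m → Σᶠ (λ l → X i l * Y l m) * Z m j)
    ≡⟨ Σᶠ-cong (λ m → *-distribʳ-Σᶠ (Z m j) (λ l → X i l * Y l m)) ⟩
  Σᶠ (λ m → Σᶠ (λ l → X i l * Y l m * Z m j))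
    ≡⟨ Σᶠ-comm (λ m l → X i l * Y l m * Z m j) ⟩
  Σᶠ (λ l → Σᶠ (λ m → X i l * Y l m * Z m j))
    ≡⟨ Σᶠ-cong (λ l → Σᶠ-cong (λ m → ℤ.*-assoc (X i l) (Y l m) (Z m j))) ⟩
  Σᶠ (λ l → Σᶠ (λ m → X i l * (Y l m * Z m j)))
    ≡⟨ Σᶠ-cong (λ l → *-distribˡ-Σᶠ (X i l) (λ m → Y l m * Z m j)) ⟨
  Σᶠ (λ l → X i l * Σᶠ (λ m → Y l m * Z m j))
    ∎
  where open ≡-Reasoning

idM-off : ∀ {n} {i j : Fin n} → i ≢ j → idM i j ≡ 0ℤ
idM-off {i = i} {j} i≢j with toℕ i ℕ.≟ toℕ j
... | yes i≡j = ⊥-elim (i≢j (Fin.toℕ-injective i≡j))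
... | no _    = refl

idM-diag : ∀ {n} (i : Fin n) → idM i i ≡ 1ℤ
idM-diag i with toℕ i ℕ.≟ toℕ i
... | yes _  = refl
... | no i≢i = ⊥-elim (i≢i refl)

⊗-identityˡ : ∀ {r c} (X : Mat r c) → (idM ⊗ X) ≐ X
⊗-identityˡ X i j =
  trans (Σᶠ-select (λ l → idM i l * X l j) i (λ l l≢i → cong (_* X l j) (idM-off (l≢i ∘ sym))))
        (trans (cong (_* X i j) (idM-diag i)) (ℤ.*-identityˡ (X i j)))

⊗-identityʳ : ∀ {r c} (X : Mat r c) → (X ⊗ idM) ≐ X
⊗-identityʳ X i j =
  trans (Σᶠ-select (λ l → X i l * idM l j) j
                   (λ l l≢j → trans (cong (X i l *_) (idM-off l≢j)) (ℤ.*-zeroʳ (X i l))))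
        (trans (cong (X i j *_) (idM-diag j)) (ℤ.*-identityʳ (X i j)))

GL-cancelˡ : ∀ {r c} (W U : Mat r r) (X : Mat r c) → (W ⊗ U) ≐ idM → (W ⊗ (U ⊗ X)) ≐ X
GL-cancelˡ W U X WU≐I =
  ≐-trans (≐-sym (⊗-assoc W U X)) (≐-trans (⊗-cong WU≐I (≐-refl {X = X})) (⊗-identityˡ X))

GL-cancelʳ : ∀ {r c} (X : Mat r c) (V Z : Mat c c) → (V ⊗ Z) ≐ idM → ((X ⊗ V) ⊗ Z) ≐ X
GL-cancelʳ X V Z VZ≐I =
  ≐-trans (⊗-assoc X V Z) (≐-trans (⊗-cong (≐-refl {X = X}) VZ≐I) (⊗-identityʳ X))

_ᵀ : ∀ {r c} → Mat r c → Mat c r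
(M ᵀ) i j = M j i

minor : ∀ {r c k} → Mat r c → (Fin k → Fin r) → (Fin k → Fin c) → Mat k k
minor X h κ a b = X (h a) (κ b)

minor₀ : ∀ {n} → Mat (suc n) (suc n) → Fin (suc n) → Mat n n
minor₀ M j a b = M (suc a) (punchIn j b)

-- Determinants

det-cong : ∀ {n} {M N : Mat n n} → M ≐ N → det M ≡ det N
det-cong {zero}  M≐N = refl
det-cong {suc n} M≐N = Σᶠ-cong (λ j →
  cong₂ (λ x y → sgn (toℕ j) * (x * y)) (M≐N zero j) (det-cong (λ a b → M≐N (suc a) (punchIn j b))))

-- Expanding the minors once more, both sides become the same double sum over pairs of entries
-- M 0 (suc j) and M (suc i) 0.
det-expand-col₀ : ∀ {n} (M : Mat (suc n) (suc n)) →
  det M ≡ Σᶠ (λ i → sgn (toℕ i) * (M i zero * det (λ a b → M (punchIn i a) (suc b))))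
det-expand-col₀ {zero}  M = refl
det-expand-col₀ {suc n} M = cong (sgn 0 * (M zero zero * det (λ a b → M (suc a) (suc b))) +_) (begin
  Σᶠ (λ j → - s j * (M zero (suc j) * det (minor₀ M (suc j))))
    ≡⟨ Σᶠ-cong (λ j → cong (λ x → - s j * (M zero (suc j) * x)) (det-expand-col₀ (minor₀ M (suc j)))) ⟩
  Σᶠ (λ j → - s j * (M zero (suc j) * Σᶠ (λ i → s i * (M (suc i) zero * det (N i j)))))
    ≡⟨ Σᶠ-cong (λ j → pull-inside (s j) (M zero (suc j)) (λ i →
         term≡ (s j) (s i) (M zero (suc j)) (M (suc i) zero) (det (N i j)))) ⟩
  Σᶠ (λ j → Σᶠ (λ i → term i j))
    ≡⟨ Σᶠ-comm (λ j i → term i j) ⟩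
  Σᶠ (λ i → Σᶠ (λ j → term i j))
    ≡⟨ Σᶠ-cong (λ i → pull-inside (s i) (M (suc i) zero) (λ j →
         term≡′ (s i) (s j) (M (suc i) zero) (M zero (suc j)) (det (N i j)))) ⟨
  Σᶠ (λ i → - s i * (M (suc i) zero * Σᶠ (λ j → s j * (M zero (suc j) * det (N i j)))))
    ∎)
  where
  open ≡-Reasoning
  s : Fin (suc n) → ℤ
  s i = sgn (toℕ i)
  N : Fin (suc n) → Fin (suc n) → Mat n n
  N i j a b = M (suc (punchIn i a)) (suc (punchIn j b))
  term : Fin (suc n) → Fin (suc n) → ℤ
  term i j = - (s i * s j) * (M (suc i) zero * M zero (suc j) * det (N i j))
  pull-inside : ∀ {m} t x {f g : Fin m → ℤ} → (∀ i → - t * x * f i ≡ g i) → - t * (x * Σᶠ f) ≡ Σᶠ g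
  pull-inside t x {f} {g} txf≗g = trans (sym (ℤ.*-assoc (- t) x (Σᶠ f))) (scale-Σᶠ (- t * x) f g txf≗g)
  term≡ : ∀ t u y x d → - t * y * (u * (x * d)) ≡ - (u * t) * (x * y * d)
  term≡ = solve-∀
  term≡′ : ∀ t u x y d → - t * x * (u * (y * d)) ≡ - (t * u) * (x * y * d)
  term≡′ = solve-∀

det-transpose : ∀ {n} (M : Mat n n) → det (M ᵀ) ≡ det M
det-transpose {zero}  M = refl
det-transpose {suc n} M =
  trans (Σᶠ-cong (λ j → cong (λ x → sgn (toℕ j) * (M j zero * x))
                             (det-transpose (λ a b → M (punchIn j a) (suc b)))))
        (sym (det-expand-col₀ M))

swap₀₁ : ∀ {n} → Fin (suc (suc n)) → Fin (suc (suc n))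
swap₀₁ zero          = suc zero
swap₀₁ (suc zero)    = zero
swap₀₁ (suc (suc x)) = suc (suc x)

-- The first two terms of the expansion along the first row trade places with opposite signs; in the
-- other terms the swap happens inside the minor.
det-swap-cols₀₁ : ∀ {n} (M : Mat (suc (suc n)) (suc (suc n))) → det (λ a b → M a (swap₀₁ b)) ≡ - det M
det-swap-cols₀₁-minor : ∀ {n} (M : Mat (suc (suc n)) (suc (suc n))) (j : Fin n) →
  det (minor₀ (λ a b → M a (swap₀₁ b)) (suc (suc j))) ≡ - det (minor₀ M (suc (suc j)))

det-swap-cols₀₁ {n} M = begin
  sgn 0 * (M zero (suc zero) * det (minor₀ M′ zero))
    + (sgn 1 * (M zero zero * det (minor₀ M′ (suc zero))) + Σᶠ later′)
    ≡⟨ cong₂ (λ x y → sgn 0 * (M zero (suc zero) * x) + (sgn 1 * (M zero zero * y) + Σᶠ later′))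
             (det-cong {M = minor₀ M′ zero} {minor₀ M (suc zero)} (λ { a zero → refl ; a (suc b) → refl }))
             (det-cong {M = minor₀ M′ (suc zero)} {minor₀ M zero} (λ { a zero → refl ; a (suc b) → refl })) ⟩
  sgn 0 * (M zero (suc zero) * D₁) + (sgn 1 * (M zero zero * D₀) + Σᶠ later′)
    ≡⟨ cong (λ x → sgn 0 * (M zero (suc zero) * D₁) + (sgn 1 * (M zero zero * D₀) + x))
            (trans (Σᶠ-cong later-negated) (sym (neg-distrib-Σᶠ later))) ⟩
  sgn 0 * (M zero (suc zero) * D₁) + (sgn 1 * (M zero zero * D₀) + - Σᶠ later)
    ≡⟨ antisymmetric (M zero (suc zero) * D₁) (M zero zero * D₀) (Σᶠ later) ⟩
  - (sgn 0 * (M zero zero * D₀) + (sgn 1 * (M zero (suc zero) * D₁) + Σᶠ later))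
    ∎
  where
  open ≡-Reasoning
  M′ : Mat (suc (suc n)) (suc (suc n))
  M′ a b = M a (swap₀₁ b)
  D₀ D₁ : ℤ
  D₀ = det (minor₀ M zero)
  D₁ = det (minor₀ M (suc zero))
  later later′ : Fin n → ℤ
  later  j = sgn (toℕ (suc (suc j))) * (M zero (suc (suc j)) * det (minor₀ M (suc (suc j))))
  later′ j = sgn (toℕ (suc (suc j))) * (M zero (suc (suc j)) * det (minor₀ M′ (suc (suc j))))
  pull-neg : ∀ s x y → s * (x * - y) ≡ - (s * (x * y))
  pull-neg = solve-∀
  later-negated : ∀ j → later′ j ≡ - later j
  later-negated j =
    trans (cong (λ x → sgn (toℕ (suc (suc j))) * (M zero (suc (suc j)) * x)) (det-swap-cols₀₁-minor M j))
          (pull-neg (sgn (toℕ (suc (suc j)))) (M zero (suc (suc j))) (det (minor₀ M (suc (suc j)))))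
  antisymmetric : ∀ x y z → sgn 0 * x + (sgn 1 * y + - z) ≡ - (sgn 0 * y + (sgn 1 * x + z))
  antisymmetric = solve-∀

det-swap-cols₀₁-minor {suc n} M j =
  trans (det-cong {M = minor₀ (λ a b → M a (swap₀₁ b)) (suc (suc j))}
                  {λ a b → minor₀ M (suc (suc j)) a (swap₀₁ b)}
                  (λ { a zero → refl ; a (suc zero) → refl ; a (suc (suc b)) → refl }))
        (det-swap-cols₀₁ (minor₀ M (suc (suc j))))

det-swap-rows₀₁ : ∀ {n} (M : Mat (suc (suc n)) (suc (suc n))) → det (λ a b → M (swap₀₁ a) b) ≡ - det M
det-swap-rows₀₁ M =
  trans (det-transpose (λ a b → M (swap₀₁ b) a))
        (trans (det-swap-cols₀₁ (M ᵀ)) (cong -_ (det-transpose M)))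

-- A repeated first row is first moved to the second position, after which the expansion along the
-- first row reduces to minors with two equal rows.
det-equal-rows : ∀ {n} (M : Mat n n) {a b : Fin n} → a ≢ b → (∀ c → M a c ≡ M b c) → det M ≡ 0ℤ
det-equal-row₀ : ∀ {n} (M : Mat (suc n) (suc n)) (b : Fin n) →
  (∀ c → M zero c ≡ M (suc b) c) → det M ≡ 0ℤ
det-equal-rows-suc : ∀ {n} (M : Mat (suc n) (suc n)) {a b : Fin n} → a ≢ b →
  (∀ c → M (suc a) c ≡ M (suc b) c) → det M ≡ 0ℤ

det-equal-rows M {zero}  {zero}  0≢0 _    = ⊥-elim (0≢0 refl)
det-equal-rows M {zero}  {suc b} _   same = det-equal-row₀ M b same
det-equal-rows M {suc a} {zero}  _   same = det-equal-row₀ M a (sym ∘ same)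
det-equal-rows M {suc a} {suc b} a≢b same = det-equal-rows-suc M (a≢b ∘ cong suc) same

det-equal-row₀ M zero same = i≡-i⇒i≡0 (trans (det-cong swap-fixes) (det-swap-rows₀₁ M))
  where
  swap-fixes : M ≐ (λ a c → M (swap₀₁ a) c)
  swap-fixes zero          c = same c
  swap-fixes (suc zero)    c = sym (same c)
  swap-fixes (suc (suc a)) c = refl
det-equal-row₀ {n} M (suc b) same = begin
  det M      ≡⟨ ℤ.neg-involutive (det M) ⟨
  - - det M  ≡⟨ cong -_ (det-swap-rows₀₁ M) ⟨
  - det M′   ≡⟨ cong -_ (det-equal-rows-suc M′ {zero} {suc b} (λ ()) same) ⟩
  0ℤ         ∎
  where
  open ≡-Reasoning
  M′ : Mat (suc n) (suc n)
  M′ a c = M (swap₀₁ a) c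

det-equal-rows-suc M a≢b same = Σᶠ-zero (λ j →
  trans (cong (λ x → sgn (toℕ j) * (M zero j * x)) (det-equal-rows (minor₀ M j) a≢b (same ∘ punchIn j)))
        (trans (cong (sgn (toℕ j) *_) (ℤ.*-zeroʳ (M zero j))) (ℤ.*-zeroʳ (sgn (toℕ j)))))

det-equal-cols : ∀ {n} (M : Mat n n) {a b : Fin n} → a ≢ b → (∀ r → M r a ≡ M r b) → det M ≡ 0ℤ
det-equal-cols M a≢b same = trans (sym (det-transpose M)) (det-equal-rows (M ᵀ) a≢b same)

-- Multilinearity in the rows: the Cauchy–Binet expansion, summed over all maps h rather than over
-- increasing ones.
det-⊗ : ∀ {k r} (P : Mat k r) (Y : Mat r k) →
  det (P ⊗ Y) ≡ Σ→ (λ h → ∏ᶠ (λ a → P a (h a)) * det (λ a b → Y (h a) b))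
det-⊗ {zero}  P Y = refl
det-⊗ {suc k} {r} P Y = begin
  Σᶠ (λ j → s j * ((P ⊗ Y) zero j * det (minor₀ (P ⊗ Y) j)))
    ≡⟨ Σᶠ-cong (λ j → cong (λ x → s j * ((P ⊗ Y) zero j * x)) (det-⊗ (P ∘ suc) (λ l b → Y l (punchIn j b)))) ⟩
  Σᶠ (λ j → s j * ((P ⊗ Y) zero j * Σ→ (λ h → c h * d j h)))
    ≡⟨ Σᶠ-cong distribute ⟩
  Σᶠ (λ j → Σᶠ (λ l → Σ→ (G j l)))
    ≡⟨ Σᶠ-comm (λ j l → Σ→ (G j l)) ⟩
  Σᶠ (λ l → Σᶠ (λ j → Σ→ (G j l)))
    ≡⟨ Σᶠ-cong (λ l → Σ→-Σᶠ-comm (λ h j → G j l h)) ⟨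
  Σᶠ (λ l → Σ→ (λ h → Σᶠ (λ j → G j l h)))
    ≡⟨ Σᶠ-cong (λ l → Σ→-cong (λ h → sym (scale-Σᶠ (P zero l * c h) (λ j → s j * (Y l j * d j h))
         (λ j → G j l h) (λ j → regroup (P zero l) (c h) (s j) (Y l j) (d j h))))) ⟩
  Σᶠ (λ l → Σ→ (λ h → P zero l * c h * Σᶠ (λ j → s j * (Y l j * d j h))))
    ∎
  where
  open ≡-Reasoning
  s : Fin (suc k) → ℤ
  s j = sgn (toℕ j)
  c : (Fin k → Fin r) → ℤ
  c h = ∏ᶠ (λ a → P (suc a) (h a))
  d : Fin (suc k) → (Fin k → Fin r) → ℤ
  d j h = det (λ a b → Y (h a) (punchIn j b))
  G : Fin (suc k) → Fin r → (Fin k → Fin r) → ℤ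
  G j l h = s j * (P zero l * Y l j * (c h * d j h))
  regroup : ∀ p c s y d → p * c * (s * (y * d)) ≡ s * (p * y * (c * d))
  regroup = solve-∀
  distribute : ∀ j → s j * ((P ⊗ Y) zero j * Σ→ (λ h → c h * d j h)) ≡ Σᶠ (λ l → Σ→ (G j l))
  distribute j = begin
    s j * (Σᶠ (λ l → P zero l * Y l j) * Σ→ (λ h → c h * d j h))
      ≡⟨ cong (s j *_) (*-distribʳ-Σᶠ (Σ→ (λ h → c h * d j h)) (λ l → P zero l * Y l j)) ⟩
    s j * Σᶠ (λ l → P zero l * Y l j * Σ→ (λ h → c h * d j h))
      ≡⟨ scale-Σᶠ (s j) (λ l → P zero l * Y l j * Σ→ (λ h → c h * d j h)) _
                  (λ l → cong (s j *_) (*-distribˡ-Σ→ (P zero l * Y l j) (λ h → c h * d j h))) ⟩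
    Σᶠ (λ l → s j * Σ→ (λ h → P zero l * Y l j * (c h * d j h)))
      ≡⟨ Σᶠ-cong (λ l → *-distribˡ-Σ→ (s j) (λ h → P zero l * Y l j * (c h * d j h))) ⟩
    Σᶠ (λ l → Σ→ (G j l))
      ∎

det-diagonal : ∀ {n} (M : Mat n n) → (∀ a b → a ≢ b → M a b ≡ 0ℤ) → det M ≡ ∏ᶠ (λ a → M a a)
det-diagonal {zero}  M off≡0 = refl
det-diagonal {suc n} M off≡0 = begin
  Σᶠ (λ j → sgn (toℕ j) * (M zero j * det (minor₀ M j)))
    ≡⟨ Σᶠ-select _ zero (λ j j≢0 →
         trans (cong (λ x → sgn (toℕ j) * (x * det (minor₀ M j))) (off≡0 zero j (j≢0 ∘ sym)))
               (ℤ.*-zeroʳ (sgn (toℕ j)))) ⟩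
  1ℤ * (M zero zero * det (minor₀ M zero))
    ≡⟨ ℤ.*-identityˡ _ ⟩
  M zero zero * det (minor₀ M zero)
    ≡⟨ cong (M zero zero *_) (det-diagonal (minor₀ M zero) (λ a b a≢b →
         off≡0 (suc a) (suc b) (a≢b ∘ Fin.suc-injective))) ⟩
  M zero zero * ∏ᶠ (λ a → M (suc a) (suc a))
    ∎
  where open ≡-Reasoning

-- Determinantal divisors

-- g divides the k-th determinantal divisor of X. Minors are taken along arbitrary maps h, κ; those
-- with a repeated row or column vanish, so this is the usual condition on all k × k minors.
DividesMinors : ∀ {r c} → ℕ → ℤ → Mat r c → Set
DividesMinors {r} {c} k g X = ∀ (h : Fin k → Fin r) (κ : Fin k → Fin c) → g ∣ det (minor X h κ)

dividesMinors-≐ : ∀ {r c k g} (X Y : Mat r c) → X ≐ Y → DividesMinors k g X → DividesMinors k g Y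
dividesMinors-≐ X Y X≐Y g∣X h κ = subst (_ ∣_) (det-cong (λ a b → X≐Y (h a) (κ b))) (g∣X h κ)

dividesMinors-reindexCols : ∀ {r c c′ k g} (X : Mat r c) (ρ : Fin c′ → Fin c) →
  DividesMinors k g X → DividesMinors k g (λ i j → X i (ρ j))
dividesMinors-reindexCols X ρ g∣X h κ = g∣X h (ρ ∘ κ)

dividesMinors-⊗ˡ : ∀ {r r′ c k g} (P : Mat r′ r) (X : Mat r c) →
  DividesMinors k g X → DividesMinors k g (P ⊗ X)
dividesMinors-⊗ˡ P X g∣X h κ =
  subst (_ ∣_) (sym (det-⊗ (λ a l → P (h a) l) (λ l b → X l (κ b))))
        (∣-Σ→ _ (λ h′ → ∣n⇒∣m*n (∏ᶠ (λ a → P (h a) (h′ a))) (g∣X h′ κ)))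

dividesMinors-⊗ʳ : ∀ {r c c′ k g} (X : Mat r c) (Q : Mat c c′) →
  DividesMinors k g X → DividesMinors k g (X ⊗ Q)
dividesMinors-⊗ʳ X Q g∣X h κ =
  subst (_ ∣_) expansion
        (∣-Σ→ _ (λ h′ → ∣n⇒∣m*n (∏ᶠ (λ a → Q (h′ a) (κ a)))
                                (subst (_ ∣_) (sym (det-transpose (minor X h h′))) (g∣X h h′))))
  where
  open ≡-Reasoning
  expansion : Σ→ (λ h′ → ∏ᶠ (λ a → Q (h′ a) (κ a)) * det (minor X h h′ ᵀ)) ≡ det (minor (X ⊗ Q) h κ)
  expansion = begin
    Σ→ (λ h′ → ∏ᶠ (λ a → Q (h′ a) (κ a)) * det (minor X h h′ ᵀ))
      ≡⟨ det-⊗ (λ a l → Q l (κ a)) (λ l b → X (h b) l) ⟨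
    det ((λ a l → Q l (κ a)) ⊗ (λ l b → X (h b) l))
      ≡⟨ det-cong (λ a b → Σᶠ-cong (λ l → ℤ.*-comm (Q l (κ a)) (X (h b) l))) ⟩
    det (minor (X ⊗ Q) h κ ᵀ)
      ≡⟨ det-transpose (minor (X ⊗ Q) h κ) ⟩
    det (minor (X ⊗ Q) h κ)
      ∎

SameDeterminantalDivisors : ∀ {r c r′ c′} → Mat r c → Mat r′ c′ → Set
SameDeterminantalDivisors X Y = ∀ k g → DividesMinors k g X ⇔ DividesMinors k g Y

sameDeterminantalDivisors-equivalent : ∀ {r c} {X S : Mat r c} {U V} → GL r U → GL c V →
  ((U ⊗ X) ⊗ V) ≐ S → SameDeterminantalDivisors X S
sameDeterminantalDivisors-equivalent {r} {c} {X} {S} {U} {V} (W , _ , WU≐I) (Z , VZ≐I , _) UXV≐S k g =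
  mk⇔ (λ g∣X → dividesMinors-≐ _ S UXV≐S (dividesMinors-⊗ʳ (U ⊗ X) V (dividesMinors-⊗ˡ U X g∣X)))
      (λ g∣S → dividesMinors-≐ _ X WSZ≐X (dividesMinors-⊗ʳ (W ⊗ S) Z (dividesMinors-⊗ˡ W S g∣S)))
  where
  open SetoidReasoning (≐-setoid r c)
  WSZ≐X : ((W ⊗ S) ⊗ Z) ≐ X
  WSZ≐X = begin
    (W ⊗ S) ⊗ Z              ≈⟨ ⊗-cong (⊗-cong (≐-refl {X = W}) UXV≐S) (≐-refl {X = Z}) ⟨
    (W ⊗ ((U ⊗ X) ⊗ V)) ⊗ Z  ≈⟨ ⊗-cong (⊗-assoc W (U ⊗ X) V) (≐-refl {X = Z}) ⟨
    ((W ⊗ (U ⊗ X)) ⊗ V) ⊗ Z  ≈⟨ ⊗-cong (⊗-cong (GL-cancelˡ W U X WU≐I) (≐-refl {X = V})) (≐-refl {X = Z}) ⟩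
    (X ⊗ V) ⊗ Z              ≈⟨ GL-cancelʳ X V Z VZ≐I ⟩
    X                        ∎

sameDeterminantalDivisors-permuteCols : ∀ {r c} (X Y : Mat r c) (U : Mat r r) (π : Permutation′ c) →
  GL r U → (U ⊗ X) ≐ (Y · π) → SameDeterminantalDivisors X Y
sameDeterminantalDivisors-permuteCols X Y U π (W , _ , WU≐I) UX≐Yπ k g = mk⇔
  (λ g∣X → dividesMinors-≐ _ Y (λ a b → cong (Y a) (inverseʳ π))
             (dividesMinors-reindexCols (Y · π) (π ⟨$⟩ˡ_)
               (dividesMinors-≐ (U ⊗ X) (Y · π) UX≐Yπ (dividesMinors-⊗ˡ U X g∣X))))
  (λ g∣Y → dividesMinors-≐ _ X (GL-cancelˡ W U X WU≐I)
             (dividesMinors-⊗ˡ W (U ⊗ X)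
               (dividesMinors-≐ (Y · π) (U ⊗ X) (≐-sym UX≐Yπ) (dividesMinors-reindexCols Y (π ⟨$⟩ʳ_) g∣Y))))

-- Smith normal form

diagonal : ∀ {r c} → Mat r c → ℕ → ℤ
diagonal {suc r} {suc c} S zero    = S zero zero
diagonal {suc r} {suc c} S (suc x) = diagonal (λ a b → S (suc a) (suc b)) x
diagonal {zero}          S x       = 0ℤ
diagonal {suc r} {zero}  S x       = 0ℤ

diagonal-at : ∀ {r c} (S : Mat r c) i j → toℕ i ≡ toℕ j → S i j ≡ diagonal S (toℕ i)
diagonal-at S zero    zero    _   = refl
diagonal-at S (suc i) (suc j) i≡j = diagonal-at (λ a b → S (suc a) (suc b)) i j (ℕ.suc-injective i≡j)

toℕ-fromℕ<-both : ∀ {x r c} (x<r : x < r) (x<c : x < c) → toℕ (fromℕ< x<r) ≡ toℕ (fromℕ< x<c)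
toℕ-fromℕ<-both x<r x<c = trans (Fin.toℕ-fromℕ< x<r) (sym (Fin.toℕ-fromℕ< x<c))

diagonal-fromℕ< : ∀ {r c x} (S : Mat r c) (x<r : x < r) (x<c : x < c) →
  diagonal S x ≡ S (fromℕ< x<r) (fromℕ< x<c)
diagonal-fromℕ< S x<r x<c =
  sym (trans (diagonal-at S _ _ (toℕ-fromℕ<-both x<r x<c)) (cong (diagonal S) (Fin.toℕ-fromℕ< x<r)))

diagonal-outside : ∀ {r c} (S : Mat r c) x → ¬ (x < r × x < c) → diagonal S x ≡ 0ℤ
diagonal-outside {zero}          S x       _       = refl
diagonal-outside {suc r} {zero}  S x       _       = refl
diagonal-outside {suc r} {suc c} S zero    outside = ⊥-elim (outside (s≤s z≤n , s≤s z≤n))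
diagonal-outside {suc r} {suc c} S (suc x) outside =
  diagonal-outside (λ a b → S (suc a) (suc b)) x (λ (x<r , x<c) → outside (s≤s x<r , s≤s x<c))

OffDiagonalZero : ∀ {r c} → Mat r c → Set
OffDiagonalZero S = ∀ i j → toℕ i ≢ toℕ j → S i j ≡ 0ℤ

diagonal-∣-entry : ∀ {r c} (S : Mat r c) → OffDiagonalZero S → ∀ i j → diagonal S (toℕ j) ∣ S i j
diagonal-∣-entry S off i j with toℕ i ℕ.≟ toℕ j
... | yes i≡j = ∣-reflexive (trans (cong (diagonal S) (sym i≡j)) (sym (diagonal-at S i j i≡j)))
... | no  i≢j = subst (diagonal S (toℕ j) ∣_) (sym (off i j i≢j)) ∣0ℤ

-- Column b of the minor is divisible by the diagonal entry in column κ b.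
∏diagonal-∣-det-minor : ∀ {r c k} (S : Mat r c) → OffDiagonalZero S →
  (h : Fin k → Fin r) (κ : Fin k → Fin c) → ∏ᶠ (λ b → diagonal S (toℕ (κ b))) ∣ det (minor S h κ)
∏diagonal-∣-det-minor {k = zero}  S off h κ = ∣-refl
∏diagonal-∣-det-minor {k = suc k} S off h κ = ∣-Σᶠ _ (λ j →
  ∣n⇒∣m*n (sgn (toℕ j))
    (subst (_∣ S (h zero) (κ j) * det (minor S (h ∘ suc) (κ ∘ punchIn j)))
           (sym (∏ᶠ-remove {i = j} (λ b → diagonal S (toℕ (κ b)))))
           (∣-* (diagonal-∣-entry S off (h zero) (κ j))
                (∏diagonal-∣-det-minor S off (h ∘ suc) (κ ∘ punchIn j)))))

module SmithNormalForm {r c} {S : Mat r c} (snf : IsSNF S) where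

  private
    off-diagonal-zero : OffDiagonalZero S
    off-diagonal-zero = proj₁ snf
    diagonal-entry-nonneg : ∀ i j → toℕ i ≡ toℕ j → 0ℤ ≤ℤ S i j
    diagonal-entry-nonneg = proj₁ (proj₂ snf)
    diagonal-entry-∣-next : ∀ i j i′ j′ → toℕ i ≡ toℕ j → toℕ i′ ≡ toℕ j′ → suc (toℕ i) ≡ toℕ i′ →
                            S i j ∣ S i′ j′
    diagonal-entry-∣-next i j i′ j′ i≡j i′≡j′ i+1≡i′ = ∣ᵤ⇒∣ (proj₂ (proj₂ snf) i j i′ j′ i≡j i′≡j′ i+1≡i′)

  diagonal-nonneg : ∀ x → 0ℤ ≤ℤ diagonal S x
  diagonal-nonneg x with x ℕ.<? r ×-dec x ℕ.<? c
  ... | yes (x<r , x<c) =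
    subst (0ℤ ≤ℤ_) (sym (diagonal-fromℕ< S x<r x<c)) (diagonal-entry-nonneg _ _ (toℕ-fromℕ<-both x<r x<c))
  ... | no outside = subst (0ℤ ≤ℤ_) (sym (diagonal-outside S x outside)) ℤ.≤-refl

  diagonal-∣-suc : ∀ x → diagonal S x ∣ diagonal S (suc x)
  diagonal-∣-suc x with suc x ℕ.<? r ×-dec suc x ℕ.<? c
  ... | yes (1+x<r , 1+x<c) =
    subst₂ _∣_ (sym (diagonal-fromℕ< S x<r x<c)) (sym (diagonal-fromℕ< S 1+x<r 1+x<c))
      (diagonal-entry-∣-next _ _ _ _ (toℕ-fromℕ<-both x<r x<c) (toℕ-fromℕ<-both 1+x<r 1+x<c)
                             (trans (cong suc (Fin.toℕ-fromℕ< x<r)) (sym (Fin.toℕ-fromℕ< 1+x<r))))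
    where
    x<r : x < r
    x<r = ℕ.<-trans (ℕ.n<1+n x) 1+x<r
    x<c : x < c
    x<c = ℕ.<-trans (ℕ.n<1+n x) 1+x<c
  ... | no outside = subst (diagonal S x ∣_) (sym (diagonal-outside S (suc x) outside)) ∣0ℤ

  diagonal-∣-mono : ∀ {x} y → x ≤ y → diagonal S x ∣ diagonal S y
  diagonal-∣-mono zero    z≤n   = ∣-refl
  diagonal-∣-mono (suc y) x≤1+y with ℕ.m≤n⇒m<n∨m≡n x≤1+y
  ... | inj₁ x<1+y = ∣-trans (diagonal-∣-mono y (ℕ.m<1+n⇒m≤n x<1+y)) (diagonal-∣-suc y)
  ... | inj₂ refl  = ∣-refl

  dividesMinors-SNF : ∀ k → DividesMinors k (prefixProduct (diagonal S) k) S
  dividesMinors-SNF k h κ with prefixProduct-∣-or-collision (diagonal S) (λ {_} {y} → diagonal-∣-mono y) k κ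
  ... | inj₁ P∣∏ = ∣-trans P∣∏ (∏diagonal-∣-det-minor S off-diagonal-zero h κ)
  ... | inj₂ (b , b′ , b≢b′ , κb≡κb′) =
    subst (_ ∣_) (sym (det-equal-cols (minor S h κ) b≢b′ (λ a → cong (S (h a)) κb≡κb′))) ∣0ℤ

  det-leading-minor : ∀ {k} (k≤r : k ≤ r) (k≤c : k ≤ c) →
    det (minor S (λ a → inject≤ a k≤r) (λ b → inject≤ b k≤c)) ≡ prefixProduct (diagonal S) k
  det-leading-minor {k} k≤r k≤c =
    trans (det-diagonal _ (λ a b a≢b → off-diagonal-zero _ _ (a≢b ∘ Fin.toℕ-injective ∘ toℕ-inject≤⁻¹ a b)))
          (∏ᶠ-cong {k} (λ a → trans (diagonal-at S _ _ (toℕ-inject≤-both a))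
                                    (cong (diagonal S) (Fin.toℕ-inject≤ a k≤r))))
    where
    toℕ-inject≤-both : ∀ a → toℕ (inject≤ a k≤r) ≡ toℕ (inject≤ a k≤c)
    toℕ-inject≤-both a = trans (Fin.toℕ-inject≤ a k≤r) (sym (Fin.toℕ-inject≤ a k≤c))
    toℕ-inject≤⁻¹ : ∀ a b → toℕ (inject≤ a k≤r) ≡ toℕ (inject≤ b k≤c) → toℕ a ≡ toℕ b
    toℕ-inject≤⁻¹ a b e = trans (sym (Fin.toℕ-inject≤ a k≤r)) (trans e (Fin.toℕ-inject≤ b k≤c))

  prefixProduct≡0⇒diagonal≡0 : ∀ x → prefixProduct (diagonal S) x ≡ 0ℤ → diagonal S x ≡ 0ℤ
  prefixProduct≡0⇒diagonal≡0 x P≡0 with ∏ᶠ≡0⇒factor≡0 _ P≡0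
  ... | a , da≡0 = 0∣⇒≡0 (subst (_∣ diagonal S x) da≡0 (diagonal-∣-mono x (ℕ.<⇒≤ (Fin.toℕ<n a))))

module _ {r c} {S S′ : Mat r c} (snf : IsSNF S) (snf′ : IsSNF S′) (same : SameDeterminantalDivisors S S′)
  where

  private
    module N  = SmithNormalForm snf
    module N′ = SmithNormalForm snf′
    P P′ : ℕ → ℤ
    P  = prefixProduct (diagonal S)
    P′ = prefixProduct (diagonal S′)

  prefixProduct-diagonal-unique : ∀ {k} → k ≤ r → k ≤ c → P k ≡ P′ k
  prefixProduct-diagonal-unique {k} k≤r k≤c = ∣-antisym-nonneg
    (prefixProduct-nonneg (diagonal S) N.diagonal-nonneg k)
    (prefixProduct-nonneg (diagonal S′) N′.diagonal-nonneg k)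
    (subst (_ ∣_) (N′.det-leading-minor k≤r k≤c) (Equivalence.to (same k _) (N.dividesMinors-SNF k) _ _))
    (subst (_ ∣_) (N.det-leading-minor k≤r k≤c) (Equivalence.from (same k _) (N′.dividesMinors-SNF k) _ _))

  -- The x-th diagonal entry is P (x + 1) / P x, unless P x = 0, when it vanishes by divisibility.
  diagonal-unique : ∀ x → diagonal S x ≡ diagonal S′ x
  diagonal-unique x with x ℕ.<? r ×-dec x ℕ.<? c
  ... | no outside = trans (diagonal-outside S x outside) (sym (diagonal-outside S′ x outside))
  ... | yes (x<r , x<c) with P x ℤ.≟ 0ℤ
  ...   | yes Px≡0 =
    trans (N.prefixProduct≡0⇒diagonal≡0 x Px≡0)
          (sym (N′.prefixProduct≡0⇒diagonal≡0 x (trans (sym Px≡P′x) Px≡0)))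
    where
    Px≡P′x : P x ≡ P′ x
    Px≡P′x = prefixProduct-diagonal-unique (ℕ.<⇒≤ x<r) (ℕ.<⇒≤ x<c)
  ...   | no Px≢0 = ℤ.*-cancelˡ-≡ (P x) _ _ {{≢-nonZero Px≢0}} (begin
    P x * diagonal S x    ≡⟨ prefixProduct-suc (diagonal S) x ⟨
    P (suc x)             ≡⟨ prefixProduct-diagonal-unique x<r x<c ⟩
    P′ (suc x)            ≡⟨ prefixProduct-suc (diagonal S′) x ⟩
    P′ x * diagonal S′ x  ≡⟨ cong (_* diagonal S′ x) (prefixProduct-diagonal-unique (ℕ.<⇒≤ x<r) (ℕ.<⇒≤ x<c)) ⟨
    P x * diagonal S′ x   ∎)
    where open ≡-Reasoning

  snf-unique : S ≐ S′
  snf-unique i j with toℕ i ℕ.≟ toℕ j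
  ... | yes i≡j =
    trans (diagonal-at S i j i≡j) (trans (diagonal-unique (toℕ i)) (sym (diagonal-at S′ i j i≡j)))
  ... | no  i≢j = trans (proj₁ snf i j i≢j) (sym (proj₁ snf′ i j i≢j))

snfOf-unique : ∀ {r c} (X Y : Mat r c) {S S′ : Mat r c} →
  IsSNFOf X S → IsSNFOf Y S′ → SameDeterminantalDivisors X Y → S ≐ S′
snfOf-unique X Y {S} {S′} (snf , _ , _ , U∈GL , V∈GL , UXV≐S) (snf′ , _ , _ , U′∈GL , V′∈GL , U′YV′≐S′) X~Y =
  snf-unique snf snf′ (λ k g → ⇔-trans (⇔-sym (X~S k g)) (⇔-trans (X~Y k g) (Y~S′ k g)))
  where
  X~S : SameDeterminantalDivisors X S
  X~S = sameDeterminantalDivisors-equivalent U∈GL V∈GL UXV≐S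
  Y~S′ : SameDeterminantalDivisors Y S′
  Y~S′ = sameDeterminantalDivisors-equivalent U′∈GL V′∈GL U′YV′≐S′

-- Compositions and the reverse-lexicographic order

sum-take-≤ : ∀ k (m : List ℕ) → sum (take k m) ≤ sum m
sum-take-≤ zero    m       = z≤n
sum-take-≤ (suc k) []      = z≤n
sum-take-≤ (suc k) (a ∷ m) = ℕ.+-monoʳ-≤ a (sum-take-≤ k m)

sum-take-< : ∀ {k} {m : List ℕ} → All (1 ≤_) m → k < length m → sum (take k m) < sum (take (suc k) m)
sum-take-< {zero}  {a ∷ m} (1≤a ∷ _)   _          = ℕ.<-≤-trans 1≤a (ℕ.≤-reflexive (sym (ℕ.+-identityʳ a)))
sum-take-< {suc k} {a ∷ m} (_ ∷ 1≤m) (s≤s k<len) = ℕ.+-monoʳ-< a (sum-take-< 1≤m k<len)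

block-of : ∀ (m : List ℕ) x → x < sum m →
  ∃ λ k → k < length m × sum (take k m) ≤ x × x < sum (take (suc k) m)
block-of (a ∷ m) x x<sum with x ℕ.<? a
... | yes x<a = 0 , s≤s z≤n , z≤n , ℕ.<-≤-trans x<a (ℕ.≤-reflexive (sym (ℕ.+-identityʳ a)))
... | no  x≮a with block-of m (x ∸ a) (ℕ.+-cancelˡ-< a _ _ (subst (_< a +ℕ sum m) (sym a+[x∸a]≡x) x<sum))
  where
  a+[x∸a]≡x : a +ℕ (x ∸ a) ≡ x
  a+[x∸a]≡x = ℕ.m+[n∸m]≡n (ℕ.≮⇒≥ x≮a)
...   | k , k<len , lo , hi =
  suc k , s≤s k<len , subst (a +ℕ sum (take k m) ≤_) a+[x∸a]≡x (ℕ.+-monoʳ-≤ a lo) ,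
                      subst (_< a +ℕ sum (take (suc k) m)) a+[x∸a]≡x (ℕ.+-monoʳ-< a hi)
  where
  a+[x∸a]≡x : a +ℕ (x ∸ a) ≡ x
  a+[x∸a]≡x = ℕ.m+[n∸m]≡n (ℕ.≮⇒≥ x≮a)

module _ {d} {m : List ℕ} (sum≡d : sum m ≡ d) where

  block-exists : ∀ (j : Fin d) → ∃ λ k → k < length m × InBlock m k j
  block-exists j = block-of m (toℕ j) (subst (toℕ j <_) (sym sum≡d) (Fin.toℕ<n j))

  block-index-< : ∀ {k} {j : Fin d} → InBlock m k j → k < length m
  block-index-< {k} {j} (lo , _) with k ℕ.<? length m
  ... | yes k<len = k<len
  ... | no  k≮len = ⊥-elim (ℕ.<-irrefl refl (ℕ.<-≤-trans (Fin.toℕ<n j) (subst (_≤ toℕ j) sum-take≡d lo)))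
    where
    sum-take≡d : sum (take k m) ≡ d
    sum-take≡d = trans (cong sum (List.take-all k m (ℕ.≮⇒≥ k≮len))) sum≡d

  block-inhabited : All (1 ≤_) m → ∀ {k} → k < length m → ∃ λ (j : Fin d) → InBlock m k j
  block-inhabited 1≤m {k} k<len =
    fromℕ< start<d , ℕ.≤-reflexive (sym (Fin.toℕ-fromℕ< start<d)) ,
    subst (_< sum (take (suc k) m)) (sym (Fin.toℕ-fromℕ< start<d)) (sum-take-< 1≤m k<len)
    where
    start<d : sum (take k m) < d
    start<d = ℕ.<-≤-trans (sum-take-< 1≤m k<len)
                          (subst (sum (take (suc k) m) ≤_) sum≡d (sum-take-≤ (suc k) m))

module _ {r c : ℕ} where

  Before-trans : ∀ {p q s : Fin r × Fin c} → Before p q → Before q s → Before p s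
  Before-trans (inj₁ i<i′)          (inj₁ i′<i″)           = inj₁ (ℕ.<-trans i<i′ i′<i″)
  Before-trans (inj₁ i<i′)          (inj₂ (i′≡i″ , _))     = inj₁ (subst (_ <_) i′≡i″ i<i′)
  Before-trans (inj₂ (i≡i′ , _))    (inj₁ i′<i″)           = inj₁ (subst (_< _) (sym i≡i′) i′<i″)
  Before-trans (inj₂ (i≡i′ , j′<j)) (inj₂ (i′≡i″ , j″<j′)) = inj₂ (trans i≡i′ i′≡i″ , ℕ.<-trans j″<j′ j′<j)

  Before-cmp : ∀ (p q : Fin r × Fin c) → Before p q ⊎ (p ≡ q ⊎ Before q p)
  Before-cmp (i , j) (i′ , j′) with ℕ.<-cmp (toℕ i) (toℕ i′)
  ... | tri< i<i′ _ _ = inj₁ (inj₁ i<i′)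
  ... | tri> _ _ i′<i = inj₂ (inj₂ (inj₁ i′<i))
  ... | tri≈ _ i≡i′ _ with ℕ.<-cmp (toℕ j) (toℕ j′)
  ...   | tri< j<j′ _ _ = inj₂ (inj₂ (inj₂ (sym i≡i′ , j<j′)))
  ...   | tri> _ _ j′<j = inj₁ (inj₂ (i≡i′ , j′<j))
  ...   | tri≈ _ j≡j′ _ = inj₂ (inj₁ (cong₂ _,_ (Fin.toℕ-injective i≡i′) (Fin.toℕ-injective j≡j′)))

  <rlex-trans : ∀ {X Y W : Mat r c} → X <rlex Y → Y <rlex W → X <rlex W
  <rlex-trans {X} {Y} {W} (i₁ , j₁ , X≡Y , X<Y) (i₂ , j₂ , Y≡W , Y<W) with Before-cmp (i₁ , j₁) (i₂ , j₂)
  ... | inj₁ p₁<p₂ =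
    i₁ , j₁ , (λ i j p<p₁ → trans (X≡Y i j p<p₁) (Y≡W i j (Before-trans p<p₁ p₁<p₂))) ,
    subst (X i₁ j₁ <ℤ_) (Y≡W i₁ j₁ p₁<p₂) X<Y
  ... | inj₂ (inj₁ refl) =
    i₁ , j₁ , (λ i j p<p₁ → trans (X≡Y i j p<p₁) (Y≡W i j p<p₁)) , ℤ.<-trans X<Y Y<W
  ... | inj₂ (inj₂ p₂<p₁) =
    i₂ , j₂ , (λ i j p<p₂ → trans (X≡Y i j (Before-trans p<p₂ p₂<p₁)) (Y≡W i j p<p₂)) ,
    subst (_<ℤ W i₂ j₂) (sym (X≡Y i₂ j₂ p₂<p₁)) Y<W

  <rlex-irrefl : ∀ {X Y : Mat r c} → X <rlex Y → ¬ (X ≐ Y)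
  <rlex-irrefl (i , j , _ , X<Y) X≐Y = ℤ.<-irrefl (X≐Y i j) X<Y

module _ {n r c} {m : List ℕ} {M : Fin (suc n) → Mat r c}
         (1≤m : All (1 ≤_) m) (sum≡1+n : sum m ≡ suc n) (chain : Chain m M) where

  chain-<rlex : ∀ {k k′} {j j′ : Fin (suc n)} → k < k′ → k′ < length m →
    InBlock m k j → InBlock m k′ j′ → M j <rlex M j′
  chain-<rlex {k} {suc k′} {j} {j′} k<1+k′ 1+k′<len j∈k j′∈1+k′ with ℕ.m≤n⇒m<n∨m≡n (ℕ.m<1+n⇒m≤n k<1+k′)
  ... | inj₂ refl = proj₂ chain k j j′ 1+k′<len j∈k j′∈1+k′
  ... | inj₁ k<k′ with block-inhabited sum≡1+n 1≤m k′<len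
    where
    k′<len : k′ < length m
    k′<len = ℕ.<-trans (ℕ.n<1+n k′) 1+k′<len
  ...   | i , i∈k′ = <rlex-trans (chain-<rlex k<k′ (ℕ.<-trans (ℕ.n<1+n k′) 1+k′<len) j∈k i∈k′)
                                 (proj₂ chain k′ i j′ 1+k′<len i∈k′ j′∈1+k′)

  chain⇒young : (τ : Permutation′ (suc n)) → (∀ j → M j ≐ M (τ ⟨$⟩ʳ j)) → Young m τ
  chain⇒young τ M≐Mτ k j j∈k with block-exists sum≡1+n (τ ⟨$⟩ʳ j)
  ... | k′ , k′<len , τj∈k′ with ℕ.<-cmp k k′
  ... | tri≈ _ refl _ = τj∈k′
  ... | tri< k<k′ _ _ = ⊥-elim (<rlex-irrefl (chain-<rlex k<k′ k′<len j∈k τj∈k′) (M≐Mτ j))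
  ... | tri> _ _ k′<k =
    ⊥-elim (<rlex-irrefl (chain-<rlex k′<k (block-index-< sum≡1+n j∈k) τj∈k′ j∈k) (≐-sym (M≐Mτ j)))

⊗-permuteCols : ∀ {r d} (U : Mat r r) (A B : Mat r d) (g σ₁ σ₂ : Permutation′ d) →
  (U ⊗ A) ≐ (B · g) → (U ⊗ (A · σ₁)) ≐ ((B · σ₂) · (σ₁ ∘ₚ g ∘ₚ flip σ₂))
⊗-permuteCols U A B g σ₁ σ₂ UA≐Bg a b = trans (UA≐Bg a (σ₁ ⟨$⟩ʳ b)) (cong (B a) (sym (inverseʳ σ₂)))

⊗-delCol : ∀ {r n} (U : Mat r r) (X Y : Mat r (suc n)) (τ : Permutation′ (suc n)) j →
  (U ⊗ X) ≐ (Y · τ) → (U ⊗ delCol X j) ≐ (delCol Y (τ ⟨$⟩ʳ j) · remove j τ)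
⊗-delCol U X Y τ j UX≐Yτ a b = trans (UX≐Yτ a (punchIn j b)) (cong (Y a) (punchIn-permute τ j b))

lemma4p14 : (n : ℕ) (A B : Mat (suc n) (suc n)) (σ₁ σ₂ : Permutation′ (suc n))
    (M : Fin (suc n) → Mat (suc n) n) (m : List ℕ) →
    Nonsingular A → Nonsingular B →
    (∀ i → IsSNFOf (delCol (A · σ₁) i) (M i)) →
    (∀ i → IsSNFOf (delCol (B · σ₂) i) (M i)) →
    All (1 ≤_) m → sum m ≡ suc n → Chain m M →
    ((A ≃UP B → Equiv (SSNF m σ₁ σ₂) A B) × (Equiv (SSNF m σ₁ σ₂) A B → A ≃UP B))
lemma4p14 n A B σ₁ σ₂ M m _ _ snfA snfB 1≤m sum≡1+n chain = forward , backward
  where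
  forward : A ≃UP B → Equiv (SSNF m σ₁ σ₂) A B
  forward (U , g , U∈GL , _ , UA≐Bg) =
    U , g , U∈GL , (τ , chain⇒young 1≤m sum≡1+n chain τ M≐Mτ , g≡σ₂τσ₁⁻¹) , UA≐Bg
    where
    τ : Permutation′ (suc n)
    τ = σ₁ ∘ₚ g ∘ₚ flip σ₂
    g≡σ₂τσ₁⁻¹ : ∀ x → g ⟨$⟩ʳ x ≡ σ₂ ⟨$⟩ʳ (τ ⟨$⟩ʳ (σ₁ ⟨$⟩ˡ x))
    g≡σ₂τσ₁⁻¹ x = sym (trans (inverseʳ σ₂) (cong (g ⟨$⟩ʳ_) (inverseʳ σ₁)))
    X Y : Fin (suc n) → Mat (suc n) n
    X j = delCol (A · σ₁) j
    Y j = delCol (B · σ₂) (τ ⟨$⟩ʳ j)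
    X~Y : ∀ j → SameDeterminantalDivisors (X j) (Y j)
    X~Y j = sameDeterminantalDivisors-permuteCols (X j) (Y j) U (remove j τ) U∈GL
              (⊗-delCol U (A · σ₁) (B · σ₂) τ j (⊗-permuteCols U A B g σ₁ σ₂ UA≐Bg))
    M≐Mτ : ∀ j → M j ≐ M (τ ⟨$⟩ʳ j)
    M≐Mτ j = snfOf-unique (X j) (Y j) (snfA j) (snfB (τ ⟨$⟩ʳ j)) (X~Y j)
  backward : Equiv (SSNF m σ₁ σ₂) A B → A ≃UP B
  backward (U , g , U∈GL , _ , UA≐Bg) = U , g , U∈GL , tt , UA≐Bg
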